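{- For $n\ge 2$ let $f_n(t)=g_{n,\lfloor n/2\rfloor}(t)$, where $$g_{n,d}(t)=\sum_{i=1}^{\min(d,n-d)} \frac{(n-i-1)!}{(d-i)!\,(n-d-i)!\,(i-1)!}\, t^i,$$ and let $r_{2m}(1)=f_{2m-1}(1)/f_{2m}(1)$. Then for all $m\ge 2$, $$m-(2m-1)\,r_{2m}(1)-(m-1)\,r_{2m}(1)^2>2-\sqrt{2}.$$
   Context: $g_{n,d}$ is Speyer's $g$-polynomial of the uniform matroid $U_{n,d}$. -}

module Defs where

open import Data.Nat as ℕ using (ℕ; zero; suc; _∸_; _⊓_; _!)
open import Data.Nat.Properties as ℕP using (_!≢0; m*n≢0)
open import Data.Nat.DivMod using (m*n/n≡m)
open import Data.Integer using (+_)
open import Data.Rational using (ℚ; 0ℚ; 1ℚ; _+_; _*_; _-_; _/_; _<_; _÷_; NonZero; Positive; NonNegative)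
open import Data.Rational.Properties
  using (*-identityˡ; *-identityʳ; normalize-pos; nonNeg+nonNeg⇒nonNeg; pos+nonNeg⇒pos; pos⇒nonNeg; pos⇒nonZero)
open import Data.Sum using (_⊎_)
open import Relation.Binary.PropositionalEquality using (_≡_; refl; cong; subst; sym; trans)

ℕ→ℚ : ℕ → ℚ
ℕ→ℚ k = (+ k) / 1

pow : ℚ → ℕ → ℚ
pow t zero    = 1ℚ
pow t (suc i) = t * pow t i

sum1 : ℕ → (ℕ → ℚ) → ℚ
sum1 zero    c = 0ℚ
sum1 (suc k) c = c (suc k) + sum1 k c

den : ℕ → ℕ → ℕ → ℕ
den n d i = ((d ∸ i) ! ℕ.* (n ∸ d ∸ i) !) ℕ.* (i ∸ 1) !

den≢0 : ∀ n d i → ℕ.NonZero (den n d i)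
den≢0 n d i = m*n≢0 _ _ {{m*n≢0 _ _ {{(d ∸ i) !≢0}} {{(n ∸ d ∸ i) !≢0}}}} {{(i ∸ 1) !≢0}}

coeff : ℕ → ℕ → ℕ → ℚ
coeff n d i = ((+ ((n ∸ i ∸ 1) !)) / den n d i) {{den≢0 n d i}}

g : ℕ → ℕ → ℚ → ℚ
g n d t = sum1 (d ⊓ (n ∸ d)) (λ i → coeff n d i * pow t i)

f : ℕ → ℚ → ℚ
f n t = g n (n ℕ./ 2) t

pow1 : ∀ i → pow 1ℚ i ≡ 1ℚ
pow1 zero    = refl
pow1 (suc i) = subst (λ x → 1ℚ * x ≡ 1ℚ) (sym (pow1 i)) (*-identityˡ 1ℚ)

coeff-pos : ∀ n d i → Positive (coeff n d i)
coeff-pos n d i = normalize-pos ((n ∸ i ∸ 1) !) (den n d i) {{den≢0 n d i}} {{(n ∸ i ∸ 1) !≢0}}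

term-pos : ∀ n d i → Positive (coeff n d i * pow 1ℚ i)
term-pos n d i = subst Positive (sym (trans′ (cong (coeff n d i *_) (pow1 i)) (*-identityʳ (coeff n d i)))) (coeff-pos n d i)
  where
  trans′ : ∀ {x y z : ℚ} → x ≡ y → y ≡ z → x ≡ z
  trans′ refl q = q

sum1-nonNeg : ∀ n d k → NonNegative (sum1 k (λ i → coeff n d i * pow 1ℚ i))
sum1-nonNeg n d zero    = _
sum1-nonNeg n d (suc k) =
  nonNeg+nonNeg⇒nonNeg (coeff n d (suc k) * pow 1ℚ (suc k)) {{pos⇒nonNeg (coeff n d (suc k) * pow 1ℚ (suc k)) {{term-pos n d (suc k)}}}}
    (sum1 k (λ i → coeff n d i * pow 1ℚ i)) {{sum1-nonNeg n d k}}

sum1-pos : ∀ n d k → Positive (sum1 (suc k) (λ i → coeff n d i * pow 1ℚ i))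
sum1-pos n d k = pos+nonNeg⇒pos (coeff n d (suc k) * pow 1ℚ (suc k)) {{term-pos n d (suc k)}}
  (sum1 k (λ i → coeff n d i * pow 1ℚ i)) {{sum1-nonNeg n d k}}

bound2m : ∀ m → (2 ℕ.* m ℕ./ 2) ⊓ (2 ℕ.* m ∸ (2 ℕ.* m ℕ./ 2)) ≡ m
bound2m m = trans (cong (λ h → h ⊓ (2 ℕ.* m ∸ h)) e) (trans (cong (m ⊓_) e2) (ℕP.⊓-idem m))
  where
  e : 2 ℕ.* m ℕ./ 2 ≡ m
  e = trans (cong (ℕ._/ 2) (ℕP.*-comm 2 m)) (m*n/n≡m m 2)
  e2 : 2 ℕ.* m ∸ m ≡ m
  e2 = trans (ℕP.m+n∸m≡n m (m ℕ.+ 0)) (ℕP.+-identityʳ m)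

f2m-pos : ∀ m → .{{ℕ.NonZero m}} → Positive (f (2 ℕ.* m) 1ℚ)
f2m-pos (suc k) = subst (λ b → Positive (sum1 b (λ i → coeff (2 ℕ.* suc k) (2 ℕ.* suc k ℕ./ 2) i * pow 1ℚ i)))
  (sym (bound2m (suc k))) (sum1-pos (2 ℕ.* suc k) (2 ℕ.* suc k ℕ./ 2) k)

f2m≢0 : ∀ m → .{{ℕ.NonZero m}} → NonZero (f (2 ℕ.* m) 1ℚ)
f2m≢0 m = pos⇒nonZero (f (2 ℕ.* m) 1ℚ) {{f2m-pos m}}

r : (m : ℕ) → .{{ℕ.NonZero m}} → ℚ
r m = (f (2 ℕ.* m ∸ 1) 1ℚ ÷ f (2 ℕ.* m) 1ℚ) {{f2m≢0 m}}

-- Dedekind lower cut of √2:  q < √2  iff  q < 0 or q² < 2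
_<√2 : ℚ → Set
q <√2 = (q < 0ℚ) ⊎ (q * q < ℕ→ℚ 2)

2-√2<_ : ℚ → Set
2-√2< x = (ℕ→ℚ 2 - x) <√2

2≤⇒nonZero : ∀ {m} → 2 ℕ.≤ m → ℕ.NonZero m
2≤⇒nonZero (ℕ.s≤s _) = _

-- With j = i - 1 and k = d - i, the coefficient of t^i in f_{2n+2} is the multinomial coefficient
-- (j+2k; j,k,k) and the one in f_{2n+3} is (j+2k+1; j,k,k+1), both ranging over j + k = n.
-- Ratios of neighbouring multinomials give Pascal-type identities which, summed over the antidiagonal,
-- show that A n = f_{2n+2}(1) (the central Delannoy numbers) and B n = f_{2n+1}(1) satisfy
--   (n+1) B (n+1) = (2n+1) A n + n B n   and   A (n+1) = 2 B (n+1) + A n.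
-- These recurrences preserve (A + B)² < 2 A², i.e. ρ = r_{2m}(1) = B/A < √2 - 1, and with κ = m - 1
--   2 - (m - (2m-1) ρ - κ ρ²) = (1 + ρ) + κ ((1 + ρ)² - 2) ≤ 1 + ρ < √2.
{-# OPTIONS --safe #-}
module Submission where

open import Defs
open import Data.Nat using (ℕ; _≤_; _∸_; _*_)
open import Data.Rational using (_-_) renaming (_*_ to _*ℚ_)
open import Data.Nat using (suc; s≤s; z≤n)
open import Data.Rational using (1ℚ)

module Arithmetic where
  open import Data.Nat using (_+_; _/_)
  open import Data.Nat.Properties using (*-comm; m+n∸m≡n; ∸-+-assoc)
  open import Data.Nat.DivMod using (m*n/n≡m; +-distrib-/-∣ʳ)
  open import Data.Nat.Divisibility using (divides)
  open import Data.Nat.Tactic.RingSolver using (solve-∀)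
  open import Relation.Binary.PropositionalEquality

  m≡n+o⇒m∸n≡o : ∀ m n o → m ≡ n + o → m ∸ n ≡ o
  m≡n+o⇒m∸n≡o _ n o refl = m+n∸m≡n n o

  m≡n+o+p⇒m∸n∸o≡p : ∀ m n o p → m ≡ n + o + p → m ∸ n ∸ o ≡ p
  m≡n+o+p⇒m∸n∸o≡p m n o p m≡ = trans (∸-+-assoc m n o) (m≡n+o⇒m∸n≡o m (n + o) p m≡)

  2*[1+n]∸1≡1+2*n : ∀ n → 2 * suc n ∸ 1 ≡ suc (2 * n)
  2*[1+n]∸1≡1+2*n n = m≡n+o⇒m∸n≡o (2 * suc n) 1 (suc (2 * n)) (split n)
    where
    split : ∀ n → 2 * suc n ≡ 1 + suc (2 * n)
    split = solve-∀

  2*n/2≡n : ∀ n → 2 * n / 2 ≡ n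
  2*n/2≡n n = trans (cong (_/ 2) (*-comm 2 n)) (m*n/n≡m n 2)

  [1+2*n]/2≡n : ∀ n → suc (2 * n) / 2 ≡ n
  [1+2*n]/2≡n n = trans (+-distrib-/-∣ʳ 1 (divides n (*-comm 2 n))) (2*n/2≡n n)

module Multinomial where
  open import Data.Nat using (_+_; _!)
  open import Data.Nat.Properties
    using (*-assoc; *-comm; +-suc; m+n∸m≡n; m≤m+n; *-cancelʳ-≡; _!≢0; _!*_!≢0; m*n≢0)
  open import Data.Nat.Divisibility using (_∣_; ∣-trans; *-monoʳ-∣)
  open import Data.Nat.Combinatorics using (k![n∸k]!∣n!)
  open import Data.Nat.Tactic.RingSolver using (solve-∀)
  open import Relation.Binary.PropositionalEquality
  open ≡-Reasoning

  m!n!∣[m+n]! : ∀ m n → m ! * n ! ∣ (m + n) !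
  m!n!∣[m+n]! m n = subst (λ x → m ! * x ! ∣ (m + n) !) (m+n∸m≡n m n) (k![n∸k]!∣n! (m≤m+n m n))

  p!q!r!∣[p+q+r]! : ∀ p q r → p ! * (q ! * r !) ∣ (p + (q + r)) !
  p!q!r!∣[p+q+r]! p q r = ∣-trans (*-monoʳ-∣ (p !) (m!n!∣[m+n]! q r)) (m!n!∣[m+n]! p (q + r))

  multinomial : ℕ → ℕ → ℕ → ℕ
  multinomial p q r = _∣_.quotient (p!q!r!∣[p+q+r]! p q r)

  multinomial-spec : ∀ p q r → (p + (q + r)) ! ≡ multinomial p q r * (p ! * (q ! * r !))
  multinomial-spec p q r = _∣_.equality (p!q!r!∣[p+q+r]! p q r)

  multinomial-step : ∀ p q r {p′ q′ r′} c → p′ + (q′ + r′) ≡ suc (p + (q + r)) →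
                     p′ ! * (q′ ! * r′ !) ≡ c * (p ! * (q ! * r !)) →
                     c * multinomial p′ q′ r′ ≡ suc (p + (q + r)) * multinomial p q r
  multinomial-step p q r {p′} {q′} {r′} c sum≡ den≡ =
    *-cancelʳ-≡ (c * M′) (suc N * M) D {{m*n≢0 (p !) (q ! * r !) {{p !≢0}} {{q !* r !≢0}}}} (begin
      c * M′ * D                   ≡⟨ cong (_* D) (*-comm c M′) ⟩
      M′ * c * D                   ≡⟨ *-assoc M′ c D ⟩
      M′ * (c * D)                 ≡⟨ cong (M′ *_) den≡ ⟨
      M′ * (p′ ! * (q′ ! * r′ !))  ≡⟨ multinomial-spec p′ q′ r′ ⟨
      (p′ + (q′ + r′)) !           ≡⟨ cong _! sum≡ ⟩
      suc N * N !                  ≡⟨ cong (suc N *_) (multinomial-spec p q r) ⟩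
      suc N * (M * D)              ≡⟨ *-assoc (suc N) M D ⟨
      suc N * M * D                ∎)
    where
    N  = p + (q + r)
    D  = p ! * (q ! * r !)
    M  = multinomial p q r
    M′ = multinomial p′ q′ r′

  private
    pull-factor : ∀ x y c z → x * (y * (c * z)) ≡ c * (x * (y * z))
    pull-factor = solve-∀

    pull-middle-factor : ∀ x c y z → x * ((c * y) * z) ≡ c * (x * (y * z))
    pull-middle-factor = solve-∀

  multinomial-suc₁ : ∀ p q r → suc p * multinomial (suc p) q r ≡ suc (p + (q + r)) * multinomial p q r
  multinomial-suc₁ p q r =
    multinomial-step p q r {suc p} {q} {r} (suc p) refl (*-assoc (suc p) (p !) (q ! * r !))

  multinomial-suc₂ : ∀ p q r → suc q * multinomial p (suc q) r ≡ suc (p + (q + r)) * multinomial p q r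
  multinomial-suc₂ p q r =
    multinomial-step p q r {p} {suc q} {r} (suc q) (+-suc p (q + r)) (pull-middle-factor (p !) (suc q) (q !) (r !))

  multinomial-suc₃ : ∀ p q r → suc r * multinomial p q (suc r) ≡ suc (p + (q + r)) * multinomial p q r
  multinomial-suc₃ p q r =
    multinomial-step p q r {p} {q} {suc r} (suc r) (trans (cong (p +_) (+-suc q r)) (+-suc p (q + r)))
      (pull-factor (p !) (q !) (suc r) (r !))

module Antidiagonal where
  open import Data.Nat using (zero; _+_)
  open import Data.Nat.Properties using (+-identityʳ; +-assoc; *-distribˡ-+; +-commutativeSemigroup)
  open import Algebra.Properties.CommutativeSemigroup +-commutativeSemigroup using (interchange)
  open import Relation.Binary.PropositionalEquality

  antidiagonal-sum : (ℕ → ℕ → ℕ) → ℕ → ℕ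
  antidiagonal-sum h zero    = h 0 0
  antidiagonal-sum h (suc n) = h 0 (suc n) + antidiagonal-sum (λ j → h (suc j)) n

  antidiagonal-sum-cong : ∀ {h h′} n → (∀ j k → j + k ≡ n → h j k ≡ h′ j k) →
                          antidiagonal-sum h n ≡ antidiagonal-sum h′ n
  antidiagonal-sum-cong zero    eq = eq 0 0 refl
  antidiagonal-sum-cong (suc n) eq =
    cong₂ _+_ (eq 0 (suc n) refl) (antidiagonal-sum-cong n (λ j k j+k≡n → eq (suc j) k (cong suc j+k≡n)))

  antidiagonal-sum-+ : ∀ h h′ n → antidiagonal-sum (λ j k → h j k + h′ j k) n ≡
                                  antidiagonal-sum h n + antidiagonal-sum h′ n
  antidiagonal-sum-+ h h′ zero    = refl
  antidiagonal-sum-+ h h′ (suc n) =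
    trans (cong (h 0 (suc n) + h′ 0 (suc n) +_) (antidiagonal-sum-+ (λ j → h (suc j)) (λ j → h′ (suc j)) n))
          (interchange (h 0 (suc n)) (h′ 0 (suc n)) _ _)

  antidiagonal-sum-* : ∀ c h n → antidiagonal-sum (λ j k → c * h j k) n ≡ c * antidiagonal-sum h n
  antidiagonal-sum-* c h zero    = refl
  antidiagonal-sum-* c h (suc n) =
    trans (cong (c * h 0 (suc n) +_) (antidiagonal-sum-* c (λ j → h (suc j)) n)) (sym (*-distribˡ-+ c _ _))

  antidiagonal-sum-last : ∀ h n → antidiagonal-sum h (suc n) ≡
                                  antidiagonal-sum (λ j k → h j (suc k)) n + h (suc n) 0
  antidiagonal-sum-last h zero    = refl
  antidiagonal-sum-last h (suc n) =
    trans (cong (h 0 (suc (suc n)) +_) (antidiagonal-sum-last (λ j → h (suc j)) n))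
          (sym (+-assoc (h 0 (suc (suc n))) _ _))

  shiftʲ : (ℕ → ℕ → ℕ) → ℕ → ℕ → ℕ
  shiftʲ h zero    k = 0
  shiftʲ h (suc j) k = h j k

  shiftᵏ : (ℕ → ℕ → ℕ) → ℕ → ℕ → ℕ
  shiftᵏ h j zero    = 0
  shiftᵏ h j (suc k) = h j k

  antidiagonal-sum-shiftᵏ : ∀ h n → antidiagonal-sum (shiftᵏ h) (suc n) ≡ antidiagonal-sum h n
  antidiagonal-sum-shiftᵏ h n = trans (antidiagonal-sum-last (shiftᵏ h) n) (+-identityʳ _)

module Delannoy where
  open import Data.Nat using (zero; _+_)
  open import Data.Nat.Properties using (*-zeroʳ; *-identityʳ; +-suc; *-cancelˡ-≡)
  open import Data.Nat.Tactic.RingSolver using (solve-∀)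
  open import Relation.Binary.PropositionalEquality
  open ≡-Reasoning
  open Multinomial using (multinomial; multinomial-spec; multinomial-suc₁; multinomial-suc₂; multinomial-suc₃)
  open Antidiagonal

  a : ℕ → ℕ → ℕ
  a j k = multinomial j k k

  b : ℕ → ℕ → ℕ
  b j k = multinomial j k (suc k)

  b-a-ratio : ∀ j k → suc k * b j k ≡ suc (j + (k + k)) * a j k
  b-a-ratio j k = multinomial-suc₃ j k k

  a-shiftʲ-ratio : ∀ j k → j * a j k ≡ (j + (k + k)) * shiftʲ a j k
  a-shiftʲ-ratio zero    k = sym (*-zeroʳ (k + k))
  a-shiftʲ-ratio (suc j) k = multinomial-suc₁ j k k

  a-shiftᵏ-ratio : ∀ j k → k * a j k ≡ (j + (k + k)) * shiftᵏ b j k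
  a-shiftᵏ-ratio j zero    = sym (*-zeroʳ (j + 0))
  a-shiftᵏ-ratio j (suc k) = trans (multinomial-suc₂ j k (suc k)) (cong (_* b j k) (sym (+-suc j (k + suc k))))

  b-shiftʲ-ratio : ∀ j k → j * b j k ≡ suc (j + (k + k)) * shiftʲ b j k
  b-shiftʲ-ratio zero    k = sym (*-zeroʳ (suc (k + k)))
  b-shiftʲ-ratio (suc j) k = trans (multinomial-suc₁ j k (suc k))
    (cong (λ s → suc s * b j k) (trans (cong (j +_) (+-suc k k)) (+-suc j (k + k))))

  a-pascal-weighted : ∀ j k → (j + (k + k)) * a j k ≡ (j + (k + k)) * (2 * shiftᵏ b j k + shiftʲ a j k)
  a-pascal-weighted j k = begin
    w * a j k
      ≡⟨ split-weight j k (a j k) ⟩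
    j * a j k + 2 * (k * a j k)
      ≡⟨ cong₂ (λ x y → x + 2 * y) (a-shiftʲ-ratio j k) (a-shiftᵏ-ratio j k) ⟩
    w * shiftʲ a j k + 2 * (w * shiftᵏ b j k)
      ≡⟨ collect w (shiftʲ a j k) (shiftᵏ b j k) ⟩
    w * (2 * shiftᵏ b j k + shiftʲ a j k)
      ∎
    where
    w = j + (k + k)
    split-weight : ∀ j k x → (j + (k + k)) * x ≡ j * x + 2 * (k * x)
    split-weight = solve-∀
    collect : ∀ w x y → w * x + 2 * (w * y) ≡ w * (2 * y + x)
    collect = solve-∀

  a-pascal : ∀ {n} j k → j + k ≡ suc n → a j k ≡ 2 * shiftᵏ b j k + shiftʲ a j k
  a-pascal zero    zero    ()
  a-pascal zero    (suc k) _ = *-cancelˡ-≡ _ _ (suc k + suc k) (a-pascal-weighted zero (suc k))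
  a-pascal (suc j) k       _ = *-cancelˡ-≡ _ _ (suc j + (k + k)) (a-pascal-weighted (suc j) k)

  b-recurrence : ∀ {n} j k → j + k ≡ n → suc n * b j k ≡ suc (n + n) * a j k + n * shiftʲ b j k
  b-recurrence j k refl = *-cancelˡ-≡ _ _ w (begin
    w * (suc s * b j k)
      ≡⟨ weights j k (b j k) ⟩
    suc (s + s) * (suc k * b j k) + s * (j * b j k)
      ≡⟨ cong₂ (λ x y → suc (s + s) * x + s * y) (b-a-ratio j k) (b-shiftʲ-ratio j k) ⟩
    suc (s + s) * (w * a j k) + s * (w * shiftʲ b j k)
      ≡⟨ collect w (suc (s + s)) s (a j k) (shiftʲ b j k) ⟩
    w * (suc (s + s) * a j k + s * shiftʲ b j k)
      ∎)
    where
    s = j + k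
    w = suc (j + (k + k))
    weights : ∀ j k x → suc (j + (k + k)) * (suc (j + k) * x) ≡
                        suc ((j + k) + (j + k)) * (suc k * x) + (j + k) * (j * x)
    weights = solve-∀
    collect : ∀ w c d x y → c * (w * x) + d * (w * y) ≡ w * (c * x + d * y)
    collect = solve-∀

  A : ℕ → ℕ
  A = antidiagonal-sum a

  -- B 0 = 0 and B (suc n) = Σ_{j+k=n} b j k hold definitionally.
  B : ℕ → ℕ
  B = antidiagonal-sum (shiftʲ b)

  A-zero : A 0 ≡ 1
  A-zero = sym (trans (multinomial-spec 0 0 0) (*-identityʳ _))

  B-recurrence : ∀ n → suc n * B (suc n) ≡ suc (n + n) * A n + n * B n
  B-recurrence n = begin
    suc n * antidiagonal-sum b n
      ≡⟨ antidiagonal-sum-* (suc n) b n ⟨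
    antidiagonal-sum (λ j k → suc n * b j k) n
      ≡⟨ antidiagonal-sum-cong n b-recurrence ⟩
    antidiagonal-sum (λ j k → suc (n + n) * a j k + n * shiftʲ b j k) n
      ≡⟨ antidiagonal-sum-+ (λ j k → suc (n + n) * a j k) (λ j k → n * shiftʲ b j k) n ⟩
    antidiagonal-sum (λ j k → suc (n + n) * a j k) n + antidiagonal-sum (λ j k → n * shiftʲ b j k) n
      ≡⟨ cong₂ _+_ (antidiagonal-sum-* (suc (n + n)) a n) (antidiagonal-sum-* n (shiftʲ b) n) ⟩
    suc (n + n) * A n + n * B n
      ∎

  A-recurrence : ∀ n → A (suc n) ≡ 2 * B (suc n) + A n
  A-recurrence n = begin
    A (suc n)
      ≡⟨ antidiagonal-sum-cong (suc n) a-pascal ⟩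
    antidiagonal-sum (λ j k → 2 * shiftᵏ b j k + shiftʲ a j k) (suc n)
      ≡⟨ antidiagonal-sum-+ (λ j k → 2 * shiftᵏ b j k) (shiftʲ a) (suc n) ⟩
    antidiagonal-sum (λ j k → 2 * shiftᵏ b j k) (suc n) + A n
      ≡⟨ cong (_+ A n) (antidiagonal-sum-* 2 (shiftᵏ b) (suc n)) ⟩
    2 * antidiagonal-sum (shiftᵏ b) (suc n) + A n
      ≡⟨ cong (λ x → 2 * x + A n) (antidiagonal-sum-shiftᵏ b n) ⟩
    2 * B (suc n) + A n
      ∎

module RatioBound where
  open import Data.Nat using (zero; _+_; _<_)
  open import Data.Nat.Properties
    using (*-cancelˡ-<; +-cancelʳ-≤; +-monoʳ-≤; *-monoʳ-≤; <⇒≤; m<m+n; module ≤-Reasoning)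
  open import Data.Nat.Tactic.RingSolver using (solve-∀)
  open import Relation.Binary.PropositionalEquality using (_≡_; sym; cong; subst; subst₂)
  open ≤-Reasoning
  open Delannoy using (A; B; A-zero; A-recurrence; B-recurrence)

  RatioBelow√2-1 : ℕ → ℕ → Set
  RatioBelow√2-1 x y = (x + y) * (x + y) < 2 * (x * x)

  RatioBelow√2-1-cancel : ∀ c x y → RatioBelow√2-1 (c * x) (c * y) → RatioBelow√2-1 x y
  RatioBelow√2-1-cancel c x y bound =
    *-cancelˡ-< (c * c) _ _ (subst₂ _<_ (sq-scale c x y) (double-sq-scale c x) bound)
    where
    sq-scale : ∀ c x y → (c * x + c * y) * (c * x + c * y) ≡ c * c * ((x + y) * (x + y))
    sq-scale = solve-∀
    double-sq-scale : ∀ c x → 2 * (c * x * (c * x)) ≡ c * c * (2 * (x * x))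
    double-sq-scale = solve-∀

  -- 2x′² - (x′ + y′)² = n² (2x² - (x + y)²) + 2(2n+1) x², stated without subtraction as step-identity.
  ratio-step : ∀ n x y → RatioBelow√2-1 x y →
               let y′ = suc (n + n) * x + n * y ; x′ = 2 * y′ + suc n * x in RatioBelow√2-1 x′ y′
  ratio-step n zero      y ()
  ratio-step n x@(suc _) y bound = begin-strict
    (x′ + y′) * (x′ + y′)        <⟨ m<m+n _ (s≤s z≤n) ⟩
    (x′ + y′) * (x′ + y′) + gap  ≤⟨ +-cancelʳ-≤ (n * n * (2 * (x * x))) _ _ (begin
      (x′ + y′) * (x′ + y′) + gap + n * n * (2 * (x * x))
        ≡⟨ step-identity n x y ⟨
      2 * (x′ * x′) + n * n * ((x + y) * (x + y))
        ≤⟨ +-monoʳ-≤ (2 * (x′ * x′)) (*-monoʳ-≤ (n * n) (<⇒≤ bound)) ⟩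
      2 * (x′ * x′) + n * n * (2 * (x * x))
        ∎) ⟩
    2 * (x′ * x′)                ∎
    where
    y′ = suc (n + n) * x + n * y
    x′ = 2 * y′ + suc n * x
    gap = 2 * suc (n + n) * (x * x)
    step-identity : ∀ n x y → let y′ = suc (n + n) * x + n * y ; x′ = 2 * y′ + suc n * x in
      2 * (x′ * x′) + n * n * ((x + y) * (x + y)) ≡
      (x′ + y′) * (x′ + y′) + 2 * suc (n + n) * (x * x) + n * n * (2 * (x * x))
    step-identity = solve-∀

  ratio-bound-suc : ∀ n {x y x′ y′} → suc n * y′ ≡ suc (n + n) * x + n * y → x′ ≡ 2 * y′ + x →
                    RatioBelow√2-1 x y → RatioBelow√2-1 x′ y′
  ratio-bound-suc n {x} {y} {x′} {y′} y′-rec x′-rec bound =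
    RatioBelow√2-1-cancel (suc n) x′ y′
      (subst₂ RatioBelow√2-1 (sym scaled-x′) (sym y′-rec) (ratio-step n x y bound))
    where
    distrib : ∀ c y x → c * (2 * y + x) ≡ 2 * (c * y) + c * x
    distrib = solve-∀
    scaled-x′ : suc n * x′ ≡ 2 * (suc (n + n) * x + n * y) + suc n * x
    scaled-x′ = begin-equality
      suc n * x′                                 ≡⟨ cong (suc n *_) x′-rec ⟩
      suc n * (2 * y′ + x)                       ≡⟨ distrib (suc n) y′ x ⟩
      2 * (suc n * y′) + suc n * x               ≡⟨ cong (λ z → 2 * z + suc n * x) y′-rec ⟩
      2 * (suc (n + n) * x + n * y) + suc n * x  ∎

  A-B-ratio-bound : ∀ n → RatioBelow√2-1 (A n) (B n)
  A-B-ratio-bound zero    = subst (λ x → RatioBelow√2-1 x 0) (sym A-zero) (s≤s (s≤s z≤n))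
  A-B-ratio-bound (suc n) = ratio-bound-suc n (B-recurrence n) (A-recurrence n) (A-B-ratio-bound n)

module Cast where
  open import Data.Nat using (_+_; _<_; NonZero)
  open import Data.Integer as ℤ using (+_; +<+)
  import Data.Integer.Properties as ℤ
  open import Data.Rational as ℚ using (mkℚ; 0ℚ; _/_; *<*)
  open import Data.Rational.Properties using (normalize-coprime; normalize-nonNeg; nonNegative⁻¹; /-cong; fromℚᵘ-cong)
  import Data.Rational.Unnormalised as ℚᵘ
  import Data.Nat.Coprimality as Coprime
  open import Relation.Binary.PropositionalEquality

  ℕ→ℚ≡mkℚ : ∀ n → ℕ→ℚ n ≡ mkℚ (+ n) 0 (Coprime.sym (Coprime.1-coprimeTo n))
  ℕ→ℚ≡mkℚ n = normalize-coprime (Coprime.sym (Coprime.1-coprimeTo n))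

  ℕ→ℚ-+ : ∀ m n → ℕ→ℚ (m + n) ≡ ℕ→ℚ m ℚ.+ ℕ→ℚ n
  ℕ→ℚ-+ m n = trans (/-cong numerator refl) (sym (cong₂ ℚ._+_ (ℕ→ℚ≡mkℚ m) (ℕ→ℚ≡mkℚ n)))
    where
    numerator : + (m + n) ≡ + m ℤ.* + 1 ℤ.+ + n ℤ.* + 1
    numerator = trans (ℤ.pos-+ m n) (sym (cong₂ ℤ._+_ (ℤ.*-identityʳ (+ m)) (ℤ.*-identityʳ (+ n))))

  ℕ→ℚ-* : ∀ m n → ℕ→ℚ (m * n) ≡ ℕ→ℚ m *ℚ ℕ→ℚ n
  ℕ→ℚ-* m n = trans (/-cong (ℤ.pos-* m n) refl) (sym (cong₂ _*ℚ_ (ℕ→ℚ≡mkℚ m) (ℕ→ℚ≡mkℚ n)))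

  ℕ→ℚ-mono-< : ∀ {m n} → m < n → ℕ→ℚ m ℚ.< ℕ→ℚ n
  ℕ→ℚ-mono-< {m} {n} m<n = subst₂ ℚ._<_ (sym (ℕ→ℚ≡mkℚ m)) (sym (ℕ→ℚ≡mkℚ n))
    (*<* (subst₂ ℤ._<_ (sym (ℤ.*-identityʳ (+ m))) (sym (ℤ.*-identityʳ (+ n))) (+<+ m<n)))

  ℕ→ℚ-nonNeg : ∀ n → 0ℚ ℚ.≤ ℕ→ℚ n
  ℕ→ℚ-nonNeg n = nonNegative⁻¹ (ℕ→ℚ n) {{normalize-nonNeg n 1}}

  +n/d≡ℕ→ℚ : ∀ n d q .{{_ : NonZero d}} → n ≡ q * d → (+ n) / d ≡ ℕ→ℚ q
  +n/d≡ℕ→ℚ _ (suc d) q refl = fromℚᵘ-cong {ℚᵘ.mkℚᵘ (+ (q * suc d)) d} {ℚᵘ.mkℚᵘ (+ q) 0}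
    (ℚᵘ.*≡* (trans (ℤ.*-identityʳ _) (ℤ.pos-* q (suc d))))

module Evaluation where
  open import Data.Nat using (zero; _+_; _!; _/_; _⊓_)
  open import Data.Nat.Properties
    using (+-comm; +-suc; +-identityʳ; *-comm; m+n∸m≡n; m≤n⇒m⊓n≡m; ≤-reflexive; ≤-trans; n≤1+n)
  open import Data.Nat.Tactic.RingSolver using (solve-∀)
  open import Data.Rational as ℚ using (ℚ)
  import Data.Rational.Properties as ℚ
  open import Relation.Binary.PropositionalEquality
  open ≡-Reasoning
  open Arithmetic
  open Multinomial using (multinomial; multinomial-spec)
  open Antidiagonal using (antidiagonal-sum; antidiagonal-sum-last)
  open Delannoy using (a; b; A; B)
  open RatioBound using (RatioBelow√2-1; A-B-ratio-bound)
  open Cast using (ℕ→ℚ-+; ℕ→ℚ-*; ℕ→ℚ-mono-<; +n/d≡ℕ→ℚ)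

  sum1-antidiagonal : ∀ (u : ℕ → ℚ) h n → (∀ j k → j + k ≡ n → u (suc j) ≡ ℕ→ℚ (h j k)) →
                      sum1 (suc n) u ≡ ℕ→ℚ (antidiagonal-sum h n)
  sum1-antidiagonal u h zero    eq = trans (ℚ.+-identityʳ (u 1)) (eq 0 0 refl)
  sum1-antidiagonal u h (suc n) eq = begin
    u (suc (suc n)) ℚ.+ sum1 (suc n) u
      ≡⟨ cong₂ ℚ._+_ (eq (suc n) 0 (+-identityʳ (suc n))) (sum1-antidiagonal u h′ n eq′) ⟩
    ℕ→ℚ (h (suc n) 0) ℚ.+ ℕ→ℚ (antidiagonal-sum h′ n)
      ≡⟨ ℕ→ℚ-+ (h (suc n) 0) _ ⟨
    ℕ→ℚ (h (suc n) 0 + antidiagonal-sum h′ n)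
      ≡⟨ cong ℕ→ℚ (+-comm (h (suc n) 0) _) ⟩
    ℕ→ℚ (antidiagonal-sum h′ n + h (suc n) 0)
      ≡⟨ cong ℕ→ℚ (antidiagonal-sum-last h n) ⟨
    ℕ→ℚ (antidiagonal-sum h (suc n))
      ∎
    where
    h′ = λ j k → h j (suc k)
    eq′ : ∀ j k → j + k ≡ n → u (suc j) ≡ ℕ→ℚ (h′ j k)
    eq′ j k j+k≡n = eq j (suc k) (trans (+-suc j k) (cong suc j+k≡n))

  coeff≡multinomial : ∀ N d p q r → d ∸ suc p ≡ q → N ∸ d ∸ suc p ≡ r → N ∸ suc p ∸ 1 ≡ p + (q + r) →
                      coeff N d (suc p) ≡ ℕ→ℚ (multinomial p q r)
  coeff≡multinomial N d p q r refl refl N∸p∸1≡ =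
    +n/d≡ℕ→ℚ ((N ∸ suc p ∸ 1) !) (den N d (suc p)) (multinomial p q r) {{den≢0 N d (suc p)}} (begin
      (N ∸ suc p ∸ 1) !                        ≡⟨ cong _! N∸p∸1≡ ⟩
      (p + (q + r)) !                          ≡⟨ multinomial-spec p q r ⟩
      multinomial p q r * (p ! * (q ! * r !))  ≡⟨ cong (multinomial p q r *_) (*-comm (p !) _) ⟩
      multinomial p q r * ((q ! * r !) * p !)  ∎)

  coeff-even : ∀ {n} j k → j + k ≡ n → coeff (2 * suc n) (suc n) (suc j) ≡ ℕ→ℚ (a j k)
  coeff-even j k refl = coeff≡multinomial N (suc (j + k)) j k k (m+n∸m≡n j k)
    (m≡n+o+p⇒m∸n∸o≡p N (suc (j + k)) (suc j) k (split₁ j k))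
    (m≡n+o+p⇒m∸n∸o≡p N (suc j) 1 (j + (k + k)) (split₂ j k))
    where
    N = 2 * suc (j + k)
    split₁ : ∀ j k → 2 * suc (j + k) ≡ suc (j + k) + suc j + k
    split₁ = solve-∀
    split₂ : ∀ j k → 2 * suc (j + k) ≡ suc j + 1 + (j + (k + k))
    split₂ = solve-∀

  coeff-odd : ∀ {n} j k → j + k ≡ n → coeff (suc (2 * suc n)) (suc n) (suc j) ≡ ℕ→ℚ (b j k)
  coeff-odd j k refl = coeff≡multinomial N (suc (j + k)) j k (suc k) (m+n∸m≡n j k)
    (m≡n+o+p⇒m∸n∸o≡p N (suc (j + k)) (suc j) (suc k) (split₁ j k))
    (m≡n+o+p⇒m∸n∸o≡p N (suc j) 1 (j + (k + suc k)) (split₂ j k))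
    where
    N = suc (2 * suc (j + k))
    split₁ : ∀ j k → suc (2 * suc (j + k)) ≡ suc (j + k) + suc j + suc k
    split₁ = solve-∀
    split₂ : ∀ j k → suc (2 * suc (j + k)) ≡ suc j + 1 + (j + (k + suc k))
    split₂ = solve-∀

  term-at-1 : ∀ {c q} i → c ≡ q → c *ℚ pow 1ℚ i ≡ q
  term-at-1 {c} i c≡q = trans (cong (c *ℚ_) (pow1 i)) (trans (ℚ.*-identityʳ c) c≡q)

  f-even : ∀ n → f (2 * suc n) 1ℚ ≡ ℕ→ℚ (A n)
  f-even n = begin
    g N (N / 2) 1ℚ
      ≡⟨ cong (λ d → g N d 1ℚ) (2*n/2≡n (suc n)) ⟩
    sum1 (suc n ⊓ (N ∸ suc n)) terms
      ≡⟨ cong (λ t → sum1 t terms) (m≤n⇒m⊓n≡m (≤-reflexive (sym N∸[1+n]≡1+n))) ⟩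
    sum1 (suc n) terms
      ≡⟨ sum1-antidiagonal terms a n (λ j k e → term-at-1 (suc j) (coeff-even j k e)) ⟩
    ℕ→ℚ (A n)
      ∎
    where
    N = 2 * suc n
    terms = λ i → coeff N (suc n) i *ℚ pow 1ℚ i
    split : ∀ n → 2 * suc n ≡ suc n + suc n
    split = solve-∀
    N∸[1+n]≡1+n = m≡n+o⇒m∸n≡o N (suc n) (suc n) (split n)

  f-odd : ∀ n → f (suc (2 * n)) 1ℚ ≡ ℕ→ℚ (B n)
  f-odd zero    = refl
  f-odd (suc n) = begin
    g N (N / 2) 1ℚ
      ≡⟨ cong (λ d → g N d 1ℚ) ([1+2*n]/2≡n (suc n)) ⟩
    sum1 (suc n ⊓ (N ∸ suc n)) terms
      ≡⟨ cong (λ t → sum1 t terms) (m≤n⇒m⊓n≡m (≤-trans (n≤1+n (suc n)) (≤-reflexive (sym N∸[1+n]≡2+n)))) ⟩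
    sum1 (suc n) terms
      ≡⟨ sum1-antidiagonal terms b n (λ j k e → term-at-1 (suc j) (coeff-odd j k e)) ⟩
    ℕ→ℚ (B (suc n))
      ∎
    where
    N = suc (2 * suc n)
    terms = λ i → coeff N (suc n) i *ℚ pow 1ℚ i
    split : ∀ n → suc (2 * suc n) ≡ suc n + suc (suc n)
    split = solve-∀
    N∸[1+n]≡2+n = m≡n+o⇒m∸n≡o N (suc n) (suc (suc n)) (split n)

  ℕ→ℚ-ratio-bound : ∀ {x y} → RatioBelow√2-1 x y →
                    let x̂ = ℕ→ℚ x ; ŷ = ℕ→ℚ y in (x̂ ℚ.+ ŷ) *ℚ (x̂ ℚ.+ ŷ) ℚ.< ℕ→ℚ 2 *ℚ (x̂ *ℚ x̂)
  ℕ→ℚ-ratio-bound {x} {y} bound = subst₂ ℚ._<_ sq-cast double-sq-cast (ℕ→ℚ-mono-< bound)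
    where
    sq-cast : ℕ→ℚ ((x + y) * (x + y)) ≡ (ℕ→ℚ x ℚ.+ ℕ→ℚ y) *ℚ (ℕ→ℚ x ℚ.+ ℕ→ℚ y)
    sq-cast = trans (ℕ→ℚ-* (x + y) (x + y)) (cong₂ _*ℚ_ (ℕ→ℚ-+ x y) (ℕ→ℚ-+ x y))
    double-sq-cast : ℕ→ℚ (2 * (x * x)) ≡ ℕ→ℚ 2 *ℚ (ℕ→ℚ x *ℚ ℕ→ℚ x)
    double-sq-cast = trans (ℕ→ℚ-* 2 (x * x)) (cong (ℕ→ℚ 2 *ℚ_) (ℕ→ℚ-* x x))

  f-ratio-bound : ∀ n → let α = f (2 * suc n) 1ℚ ; β = f (2 * suc n ∸ 1) 1ℚ in
                  (α ℚ.+ β) *ℚ (α ℚ.+ β) ℚ.< ℕ→ℚ 2 *ℚ (α *ℚ α)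
  f-ratio-bound n = subst₂ (λ α β → (α ℚ.+ β) *ℚ (α ℚ.+ β) ℚ.< ℕ→ℚ 2 *ℚ (α *ℚ α))
    (sym (f-even n)) (sym (trans (cong (λ N → f N 1ℚ) (2*[1+n]∸1≡1+2*n n)) (f-odd n)))
    (ℕ→ℚ-ratio-bound {A n} {B n} (A-B-ratio-bound n))

module SqrtTwo where
  open import Data.Nat as ℕ using ()
  import Data.Nat.Properties as ℕ
  open import Data.Rational using (0ℚ; _+_; -_; _<_; _÷_; Positive; nonNegative) renaming (_≤_ to _≤ℚ_)
  open import Data.Rational.Properties
    using (_<?_; ≮⇒≥; <⇒≤; ≤-trans; ≤-<-trans; *-monoˡ-≤-nonNeg; *-monoʳ-≤-nonNeg; *-cancelʳ-<-nonNeg;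
           +-monoʳ-≤; +-monoˡ-<; +-identityʳ; +-inverseʳ; *-zeroʳ; *-assoc; *-identityʳ; *-inverseˡ;
           pos⇒nonZero; pos⇒nonNeg; pos*pos⇒pos)
  open import Data.Rational.Solver using (module +-*-Solver)
  open import Data.Sum using (inj₁; inj₂)
  open import Relation.Nullary using (yes; no)
  open import Relation.Binary.PropositionalEquality
  open +-*-Solver
  open Arithmetic using (2*[1+n]∸1≡1+2*n)
  open Cast using (ℕ→ℚ-+; ℕ→ℚ-nonNeg)

  ≤∧sq<2⇒<√2 : ∀ {x y} → x ≤ℚ y → y *ℚ y < ℕ→ℚ 2 → x <√2
  ≤∧sq<2⇒<√2 {x} {y} x≤y y²<2 with x <? 0ℚ
  ... | yes x<0 = inj₁ x<0
  ... | no  x≮0 = inj₂ (≤-<-trans (≤-trans x²≤xy xy≤y²) y²<2)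
    where
    0≤x = ≮⇒≥ x≮0
    x²≤xy : x *ℚ x ≤ℚ x *ℚ y
    x²≤xy = *-monoˡ-≤-nonNeg x {{nonNegative 0≤x}} x≤y
    xy≤y² : x *ℚ y ≤ℚ y *ℚ y
    xy≤y² = *-monoʳ-≤-nonNeg y {{nonNegative (≤-trans 0≤x x≤y)}} x≤y

  2-√2<-rational : ∀ κ ρ → 0ℚ ≤ℚ κ → (1ℚ + ρ) *ℚ (1ℚ + ρ) < ℕ→ℚ 2 →
                   2-√2< ((κ + 1ℚ) - (κ + κ + 1ℚ) *ℚ ρ - κ *ℚ (ρ *ℚ ρ))
  2-√2<-rational κ ρ 0≤κ sq<2 = ≤∧sq<2⇒<√2 below-1+ρ sq<2
    where
    sq = (1ℚ + ρ) *ℚ (1ℚ + ρ)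
    rearranged : ℕ→ℚ 2 - ((κ + 1ℚ) - (κ + κ + 1ℚ) *ℚ ρ - κ *ℚ (ρ *ℚ ρ)) ≡
                 (1ℚ + ρ) + κ *ℚ (sq - ℕ→ℚ 2)
    rearranged = solve 2 (λ k r → con (ℕ→ℚ 2) :- ((k :+ con 1ℚ) :- (k :+ k :+ con 1ℚ) :* r :- k :* (r :* r))
                                  := (con 1ℚ :+ r) :+ k :* ((con 1ℚ :+ r) :* (con 1ℚ :+ r) :- con (ℕ→ℚ 2)))
                         refl κ ρ
    sq-2≤0 : sq - ℕ→ℚ 2 ≤ℚ 0ℚ
    sq-2≤0 = <⇒≤ (subst (sq - ℕ→ℚ 2 <_) (+-inverseʳ (ℕ→ℚ 2)) (+-monoˡ-< (- ℕ→ℚ 2) sq<2))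
    correction≤0 : κ *ℚ (sq - ℕ→ℚ 2) ≤ℚ 0ℚ
    correction≤0 = subst (κ *ℚ (sq - ℕ→ℚ 2) ≤ℚ_) (*-zeroʳ κ)
                         (*-monoˡ-≤-nonNeg κ {{nonNegative 0≤κ}} sq-2≤0)
    below-1+ρ : ℕ→ℚ 2 - ((κ + 1ℚ) - (κ + κ + 1ℚ) *ℚ ρ - κ *ℚ (ρ *ℚ ρ)) ≤ℚ 1ℚ + ρ
    below-1+ρ = subst₂ _≤ℚ_ (sym rearranged) (+-identityʳ (1ℚ + ρ)) (+-monoʳ-≤ (1ℚ + ρ) correction≤0)

  2-√2<-bound : ∀ n ρ → (1ℚ + ρ) *ℚ (1ℚ + ρ) < ℕ→ℚ 2 →
                2-√2< (ℕ→ℚ (suc n) - ℕ→ℚ (2 * suc n ∸ 1) *ℚ ρ - ℕ→ℚ n *ℚ (ρ *ℚ ρ))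
  2-√2<-bound n ρ sq<2 = subst₂ (λ μ τ → 2-√2< (μ - τ *ℚ ρ - κ *ℚ (ρ *ℚ ρ))) (sym μ≡) (sym τ≡)
    (2-√2<-rational κ ρ (ℕ→ℚ-nonNeg n) sq<2)
    where
    open ≡-Reasoning
    κ = ℕ→ℚ n
    μ≡ : ℕ→ℚ (suc n) ≡ κ + 1ℚ
    μ≡ = trans (cong ℕ→ℚ (ℕ.+-comm 1 n)) (ℕ→ℚ-+ n 1)
    τ≡ : ℕ→ℚ (2 * suc n ∸ 1) ≡ κ + κ + 1ℚ
    τ≡ = begin
      ℕ→ℚ (2 * suc n ∸ 1)          ≡⟨ cong ℕ→ℚ (trans (2*[1+n]∸1≡1+2*n n) (ℕ.+-comm 1 (2 * n))) ⟩
      ℕ→ℚ (n ℕ.+ (n ℕ.+ 0) ℕ.+ 1)  ≡⟨ ℕ→ℚ-+ (2 * n) 1 ⟩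
      ℕ→ℚ (n ℕ.+ (n ℕ.+ 0)) + 1ℚ   ≡⟨ cong (_+ 1ℚ) (ℕ→ℚ-+ n (n ℕ.+ 0)) ⟩
      κ + ℕ→ℚ (n ℕ.+ 0) + 1ℚ       ≡⟨ cong (λ x → κ + ℕ→ℚ x + 1ℚ) (ℕ.+-identityʳ n) ⟩
      κ + κ + 1ℚ                   ∎

  sq[1+β/α]<2 : ∀ α β .{{_ : Positive α}} → (α + β) *ℚ (α + β) < ℕ→ℚ 2 *ℚ (α *ℚ α) →
                (1ℚ + (β ÷ α) {{pos⇒nonZero α}}) *ℚ (1ℚ + (β ÷ α) {{pos⇒nonZero α}}) < ℕ→ℚ 2
  sq[1+β/α]<2 α β sq<2α² =
    *-cancelʳ-<-nonNeg (α *ℚ α) {{α²≥0}} (subst (_< ℕ→ℚ 2 *ℚ (α *ℚ α)) (sym rescaled) sq<2α²)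
    where
    ρ = (β ÷ α) {{pos⇒nonZero α}}
    α²≥0 = pos⇒nonNeg (α *ℚ α) {{pos*pos⇒pos α α}}
    ρα≡β : ρ *ℚ α ≡ β
    ρα≡β = trans (*-assoc β _ α) (trans (cong (β *ℚ_) (*-inverseˡ α {{pos⇒nonZero α}})) (*-identityʳ β))
    rescaled : (1ℚ + ρ) *ℚ (1ℚ + ρ) *ℚ (α *ℚ α) ≡ (α + β) *ℚ (α + β)
    rescaled = trans (solve 2 (λ r a → (con 1ℚ :+ r) :* (con 1ℚ :+ r) :* (a :* a) := (a :+ r :* a) :* (a :+ r :* a))
                            refl ρ α)
                     (cong (λ x → (α + x) *ℚ (α + x)) ρα≡β)

open Evaluation using (f-ratio-bound)
open SqrtTwo using (2-√2<-bound; sq[1+β/α]<2)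

lemma4p6 : (m : ℕ) → (h : 2 ≤ m) →
    2-√2< (ℕ→ℚ m - ℕ→ℚ (2 * m ∸ 1) *ℚ r m {{2≤⇒nonZero h}}
                 - ℕ→ℚ (m ∸ 1) *ℚ (r m {{2≤⇒nonZero h}} *ℚ r m {{2≤⇒nonZero h}}))
lemma4p6 (suc (suc n)) (s≤s (s≤s z≤n)) =
  2-√2<-bound (suc n) _ (sq[1+β/α]<2 α _ {{f2m-pos (suc (suc n))}} (f-ratio-bound (suc n)))
  where
  α = f (2 * suc (suc n)) 1ℚ
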